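{- For $i,j\in U$ with $i\neq j$, the operation $\eta_{i,j}$ preserves representation: if $S,R$ are families of patterns over $U$ and $R$ represents $S$, then $\eta_{i,j}R=\{\eta_{i,j}p:p\in R\}$ represents $\eta_{i,j}S=\{\eta_{i,j}p:p\in S\}$.
   Context: Let $U$ be a finite totally ordered set and $0\notin U$. A pattern over $U$ is a set $p$ of subsets of $U\cup\{0\}$ such that exactly one member of $p$ contains $0$. Let $\mathrm{lbs}(p)=\bigcup_{S\in p}S\setminus\{0\}$. For patterns $p,q$, the join $p\sqcup q$ is obtained by relating $S\in p$ and $T\in q$ whenever $S\cap T\neq\emptyset$, taking the equivalence closure on the members of $p$ and $q$, and forming the union of the members of each class. Patterns $p,q$ are consistent, $p\sim q$, if $p\sqcup q$ consists of a single set. $\eta_{i,j}p=p$ if $\{i,j\}\not\subseteq\mathrm{lbs}(p)$ and $\eta_{i,j}p=p\sqcup\{\{0\},\{i,j\}\}$ otherwise. A family $R$ represents a family $S$ if for every pattern $q$: there is $p\in S$ with $p\sim q$ if and only if there is $p'\in R$ with $p'\sim q$. -}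

module Defs where

open import Data.Bool using (Bool; true)
open import Data.Fin using (Fin; zero; suc)
open import Data.Fin.Subset using (Subset; _∈_; _∩_; _∪_; ⁅_⁆; Nonempty)
open import Data.Fin.Subset.Properties using (_∈?_; anySubset?)
open import Data.Nat using (ℕ; suc)
open import Data.Product using (Σ; ∃; _×_; _,_; proj₁)
open import Data.Product.Properties using (≡-dec)
open import Data.Sum using (_⊎_; inj₁; inj₂)
open import Data.Empty using (⊥)
open import Data.Bool.Properties using () renaming (_≟_ to _≟B_)
open import Relation.Nullary using (Dec; yes; no; ¬_)
open import Relation.Nullary.Decidable using (_×-dec_)
open import Relation.Binary.PropositionalEquality using (_≡_)
open import Relation.Binary.Construct.Closure.Equivalence using (EqClosure)

-- U = Fin n (a finite totally ordered set); U ∪ {0} is modelled by Fin (suc n),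
-- where  zero  plays the role of the extra element 0 and  suc u  the element u ∈ U.

SetSys : ℕ → Set₁
SetSys n = Subset (suc n) → Set

-- A set of subsets of U ∪ {0} given by its (decidable) characteristic function.
-- Since U ∪ {0} is finite, every set of subsets is of this form classically.
BSys : ℕ → Set
BSys n = Subset (suc n) → Bool

⟦_⟧ : ∀ {n} → BSys n → SetSys n
⟦ p ⟧ A = p A ≡ true

IsPattern : ∀ {n} → SetSys n → Set
IsPattern {n} p =
  Σ (Subset (suc n)) λ A → p A × zero ∈ A × (∀ B → p B → zero ∈ B → B ≡ A)

Node : ∀ {n} → SetSys n → SetSys n → Set
Node {n} p q = Σ (Subset (suc n)) p ⊎ Σ (Subset (suc n)) q

nodeSet : ∀ {n} {p q : SetSys n} → Node p q → Subset (suc n)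
nodeSet (inj₁ (A , _)) = A
nodeSet (inj₂ (B , _)) = B

Related : ∀ {n} {p q : SetSys n} → Node p q → Node p q → Set
Related (inj₁ (S , _)) (inj₂ (T , _)) = Nonempty (S ∩ T)
Related _ _ = ⊥

_⊔_ : ∀ {n} → SetSys n → SetSys n → SetSys n
(p ⊔ q) X =
  Σ (Node p q) λ a → ∀ u →
    (u ∈ X → ∃ λ b → EqClosure Related a b × u ∈ nodeSet b) ×
    ((∃ λ b → EqClosure Related a b × u ∈ nodeSet b) → u ∈ X)

_∼_ : ∀ {n} → SetSys n → SetSys n → Set
_∼_ {n} p q = Σ (Subset (suc n)) λ X → (p ⊔ q) X × (∀ Y → (p ⊔ q) Y → Y ≡ X)

InLbs : ∀ {n} → BSys n → Fin n → Set
InLbs {n} p u = ∃ λ (A : Subset (suc n)) → ⟦ p ⟧ A × suc u ∈ A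

inLbs? : ∀ {n} (p : BSys n) (u : Fin n) → Dec (InLbs p u)
inLbs? p u = anySubset? (λ A → (p A ≟B true) ×-dec (suc u ∈? A))

e : ∀ {n} → Fin n → Fin n → SetSys n
e i j A = A ≡ ⁅ zero ⁆ ⊎ A ≡ (⁅ suc i ⁆ ∪ ⁅ suc j ⁆)

η : ∀ {n} → Fin n → Fin n → BSys n → SetSys n
η i j p with inLbs? p i ×-dec inLbs? p j
... | yes _ = ⟦ p ⟧ ⊔ e i j
... | no _ = ⟦ p ⟧

BFam : ℕ → Set₁
BFam n = Σ Set λ I → I → BSys n

Fam : ℕ → Set₁
Fam n = Σ Set λ I → I → SetSys n

embed : ∀ {n} → BFam n → Fam n
embed (I , f) = I , λ k → ⟦ f k ⟧

ηFam : ∀ {n} → Fin n → Fin n → BFam n → Fam n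
ηFam i j (I , f) = I , λ k → η i j (f k)

PatternFamily : ∀ {n} → BFam n → Set
PatternFamily (I , f) = ∀ k → IsPattern ⟦ f k ⟧

Represents : ∀ {n} → Fam n → Fam n → Set₁
Represents {n} (IR , r) (IS , s) = ∀ (q : SetSys n) → IsPattern q →
  ((∃ λ (k : IS) → s k ∼ q) → ∃ λ (k : IR) → r k ∼ q) ×
  ((∃ λ (k : IR) → r k ∼ q) → ∃ λ (k : IS) → s k ∼ q)

-- Write q⁺ = withIJ q = q ∪ {{i},{j},{i,j}}. If i, j ∈ lbs(s) then η_{i,j}s ∼ q gives s ∼ q⁺, and
-- conversely every pattern r with r ∼ q⁺ has i, j ∈ lbs(r) (the singletons {i}, {j} can
-- only be joined to the rest through members of r) and satisfies η_{i,j}r ∼ q. If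
-- {i,j} ⊄ lbs(s) then η_{i,j}s = s, and r ∼ q implies η_{i,j}r ∼ q for every pattern r.
-- Either way a pattern q consistent with η_{i,j}s yields a pattern q′ consistent with s,
-- hence with some r ∈ R, and then η_{i,j}r ∼ q.
--
-- Consistency is not decidable here, so it is handled through a double-negated form of
-- connectedness of the join graph, which is transported along maps between join graphs.
{-# OPTIONS --safe #-}
module Submission where

open import Defs
open import Data.Bool using (true)
open import Data.Bool.Properties using (T-≡) renaming (_≟_ to _≟B_)
open import Data.Empty using (⊥; ⊥-elim)
open import Data.Fin using (Fin; zero; suc)
open import Data.Fin.Subset using (Subset; _∈_; _∉_; _∩_; _∪_; ⁅_⁆; Nonempty; _⊆_)
open import Data.Fin.Subset.Properties
  using (_∈?_; x∈p∩q⁺; x∈p∩q⁻; x∈p∪q⁺; x∈p∪q⁻; ⊆-antisym; x∈⁅x⁆; x∈⁅y⁆⇒x≡y; nonempty?; anySubset?)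
open import Data.Nat using (ℕ; zero; suc)
open import Data.Product using (Σ; ∃; _×_; _,_; proj₁; proj₂)
open import Data.Sum using (_⊎_; inj₁; inj₂)
open import Data.Unit using (⊤; tt)
open import Data.Vec using (tabulate)
open import Data.Vec.Properties using ([]=⇒lookup; lookup⇒[]=; lookup∘tabulate)
open import Function using (_∘_; id)
open import Function.Bundles using (_⇔_; mk⇔; Equivalence)
open import Function.Properties.Equivalence using (⇔-isEquivalence)
open import Relation.Binary.Core using (_=[_]⇒_)
open import Relation.Binary.Construct.Closure.Equivalence using (EqClosure; gfold; return; isEquivalence)
open import Relation.Binary.Construct.Closure.ReflexiveTransitive using (ε; _◅_; _◅◅_)
open import Relation.Binary.Construct.Closure.Symmetric using (fwd; bwd)
open import Relation.Binary.PropositionalEquality using (_≡_; _≢_; refl; sym; trans; subst)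
open import Relation.Nullary using (Dec; yes; no; ¬_; isYes)
open import Relation.Nullary.Decidable
  using (decidable-stable; toWitness; fromWitness; _×-dec_; _⊎-dec_; ¬¬-excluded-middle)
open import Relation.Nullary.Negation using (¬¬-map; contradiction)

¬¬-pull-Fin : ∀ {m} {A : Fin m → Set} → (∀ u → ¬ ¬ A u) → ¬ ¬ (∀ u → A u)
¬¬-pull-Fin {zero} _ k = k λ ()
¬¬-pull-Fin {suc m} h k =
  h zero λ a₀ → ¬¬-pull-Fin (h ∘ suc) λ a → k λ { zero → a₀ ; (suc u) → a u }

fromDec : ∀ {m} {A : Fin m → Set} → (∀ u → Dec (A u)) → Subset m
fromDec A? = tabulate (isYes ∘ A?)

∈-fromDec⁺ : ∀ {m} {A : Fin m → Set} (A? : ∀ u → Dec (A u)) {u} → A u → u ∈ fromDec A?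
∈-fromDec⁺ A? {u} a =
  lookup⇒[]= u _ (trans (lookup∘tabulate (isYes ∘ A?) u) (Equivalence.to T-≡ (fromWitness a)))

∈-fromDec⁻ : ∀ {m} {A : Fin m → Set} (A? : ∀ u → Dec (A u)) {u} → u ∈ fromDec A? → A u
∈-fromDec⁻ A? {u} u∈ = toWitness {a? = A? u}
  (Equivalence.from T-≡ (trans (sym (lookup∘tabulate (isYes ∘ A?) u)) ([]=⇒lookup u∈)))

meets-⁅⁆⇒∈ : ∀ {m} {A : Subset m} {x} → Nonempty (A ∩ ⁅ x ⁆) → x ∈ A
meets-⁅⁆⇒∈ {A = A} (_ , v∈) with x∈p∩q⁻ A _ v∈
... | v∈A , v∈x = subst (_∈ A) (x∈⁅y⁆⇒x≡y _ v∈x) v∈A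

meets-⊆ˡ : ∀ {m} {A A′ B : Subset m} → A ⊆ A′ → Nonempty (A ∩ B) → Nonempty (A′ ∩ B)
meets-⊆ˡ {A = A} A⊆A′ (v , v∈) with x∈p∩q⁻ A _ v∈
... | v∈A , v∈B = v , x∈p∩q⁺ (A⊆A′ v∈A , v∈B)

meets-⊆ʳ : ∀ {m} {A B B′ : Subset m} → B ⊆ B′ → Nonempty (A ∩ B) → Nonempty (A ∩ B′)
meets-⊆ʳ {A = A} B⊆B′ (v , v∈) with x∈p∩q⁻ A _ v∈
... | v∈A , v∈B = v , x∈p∩q⁺ (v∈A , B⊆B′ v∈B)

0∉⁅suc⁆ : ∀ {n} (k : Fin n) → zero ∉ ⁅ suc k ⁆
0∉⁅suc⁆ k 0∈ with x∈⁅y⁆⇒x≡y (suc k) 0∈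
... | ()

Covers : ∀ {n} → SetSys n → Fin (suc n) → Set
Covers P u = ∃ λ A → P A × u ∈ A

module JoinGraph {n : ℕ} (P Q : SetSys n) where

  set : Node P Q → Subset (suc n)
  set = nodeSet

  _—_ : Node P Q → Node P Q → Set
  _—_ = Related

  Linked : Node P Q → Node P Q → Set
  Linked = EqClosure _—_

  Reaches : Node P Q → Fin (suc n) → Set
  Reaches a u = ∃ λ b → Linked a b × u ∈ set b

  IsClassUnion : Node P Q → Subset (suc n) → Set
  IsClassUnion a Y = ∀ u → (u ∈ Y → Reaches a u) × (Reaches a u → u ∈ Y)

  reaches-here : ∀ a {u} → u ∈ set a → Reaches a u
  reaches-here a u∈a = a , ε , u∈a

  reaches-via : ∀ {a b u} → Linked a b → Reaches b u → Reaches a u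
  reaches-via a~b (c , b~c , u∈c) = c , a~b ◅◅ b~c , u∈c

  shared-point-linked : ∀ {A B B′ v} (a : P A) (b : Q B) (b′ : Q B′) →
    v ∈ A → v ∈ B → v ∈ B′ → Linked (inj₂ (B , b)) (inj₂ (B′ , b′))
  shared-point-linked a b b′ v∈A v∈B v∈B′ =
    bwd {b = inj₁ (_ , a)} (_ , x∈p∩q⁺ (v∈A , v∈B)) ◅ fwd (_ , x∈p∩q⁺ (v∈A , v∈B′)) ◅ ε

  linked-invariant : (I : Node P Q → Set) → (∀ {a b} → a — b → I a ⇔ I b) →
    ∀ {a b} → Linked a b → I a → I b
  linked-invariant I step a~b = Equivalence.to (gfold ⇔-isEquivalence I step a~b)

  classUnion-of-invariant : (I : Node P Q → Set) → (∀ {a b} → a — b → I a ⇔ I b) →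
    ∀ {a Y} → I a → (∀ b → I b → set b ⊆ Y) → (∀ {u} → u ∈ Y → Reaches a u) →
    IsClassUnion a Y
  classUnion-of-invariant I step Ia bound spans u =
    spans , λ (b , a~b , u∈b) → bound b (linked-invariant I step a~b Ia) u∈b

  classUnion-¬¬∃ : ∀ a → ¬ ¬ ∃ (IsClassUnion a)
  classUnion-¬¬∃ a =
    ¬¬-map (λ reaches? → fromDec reaches? , λ u → ∈-fromDec⁻ reaches? , ∈-fromDec⁺ reaches?)
           (¬¬-pull-Fin λ u → ¬¬-excluded-middle)

  classUnion-⊆ : ∀ {a b Y Z} → IsClassUnion a Y → IsClassUnion b Z → Linked b a → Y ⊆ Z
  classUnion-⊆ a∪ b∪ b~a {u} u∈Y = proj₂ (b∪ u) (reaches-via b~a (proj₁ (a∪ u) u∈Y))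

  —-⊆ˡ : ∀ {A A′} (a : P A) (a′ : P A′) {c} → A ⊆ A′ → inj₁ (A , a) — c → inj₁ (A′ , a′) — c
  —-⊆ˡ a a′ {inj₂ _} A⊆A′ meet = meets-⊆ˡ A⊆A′ meet
  —-⊆ˡ a a′ {inj₁ _} _ ()

  reaches-⊆ˡ : ∀ {A A′} (a : P A) (a′ : P A′) → A ⊆ A′ →
    ∀ {u} → Reaches (inj₁ (A , a)) u → Reaches (inj₁ (A′ , a′)) u
  reaches-⊆ˡ a a′ A⊆A′ (_ , ε , u∈A) = reaches-here _ (A⊆A′ u∈A)
  reaches-⊆ˡ a a′ A⊆A′ (b , fwd r ◅ p , u∈b) = b , fwd (—-⊆ˡ a a′ A⊆A′ r) ◅ p , u∈b
  reaches-⊆ˡ a a′ A⊆A′ (_ , _◅_ {j = inj₁ _} (bwd ()) _ , _)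
  reaches-⊆ˡ a a′ A⊆A′ (_ , _◅_ {j = inj₂ _} (bwd ()) _ , _)

  escape⇒meets : ∀ {B u} (b : Q B) → Reaches (inj₂ (B , b)) u → u ∉ B →
    ∃ λ A → P A × Nonempty (A ∩ B)
  escape⇒meets b (_ , ε , u∈B) u∉B = ⊥-elim (u∉B u∈B)
  escape⇒meets b (_ , _◅_ {j = inj₁ (A , a)} (bwd meet) _ , _) _ = A , a , meet
  escape⇒meets b (_ , _◅_ {j = inj₂ _} (bwd ()) _ , _) _
  escape⇒meets b (_ , fwd () ◅ _ , _) _

  -- P ∼ Q with the connectedness of the join graph made explicit; since reachability is
  -- undecidable, only the root is required to reach X outright.
  record Connected (X : Subset (suc n)) : Set where
    field
      root         : Node P Q
      root-reaches : ∀ {u} → u ∈ X → Reaches root u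
      set⊆         : ∀ a → set a ⊆ X
      reaches      : ∀ a {u} → u ∈ X → ¬ ¬ Reaches a u

  ∼⇒connected : P ∼ Q → ∃ Connected
  ∼⇒connected (X , (x , x∪) , unique) = X , record
    { root         = x
    ; root-reaches = λ {u} → proj₁ (x∪ u)
    ; set⊆         = set⊆
    ; reaches      = reaches
    }
    where
    set⊆ : ∀ a → set a ⊆ X
    set⊆ a {u} u∈a = decidable-stable (u ∈? X) λ u∉X → classUnion-¬¬∃ a λ (Y , a∪) →
      u∉X (subst (u ∈_) (unique Y (a , a∪)) (proj₂ (a∪ u) (reaches-here a u∈a)))

    reaches : ∀ a {u} → u ∈ X → ¬ ¬ Reaches a u
    reaches a {u} u∈X ¬reach = classUnion-¬¬∃ a λ (Y , a∪) →
      ¬reach (proj₁ (a∪ u) (subst (u ∈_) (sym (unique Y (a , a∪))) u∈X))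

  connected⇒∼ : ∀ {X} → Connected X → P ∼ Q
  connected⇒∼ {X} c = X , (root , λ u → root-reaches , λ (b , _ , u∈b) → set⊆ b u∈b) , unique
    where
    open Connected c
    unique : ∀ Y → (P ⊔ Q) Y → Y ≡ X
    unique Y (a , a∪) = ⊆-antisym
      (λ {u} u∈Y → let (b , _ , u∈b) = proj₁ (a∪ u) u∈Y in set⊆ b u∈b)
      (λ {u} u∈X → decidable-stable (u ∈? Y) λ u∉Y →
        reaches a u∈X λ reach → u∉Y (proj₂ (a∪ u) reach))

module _ {n : ℕ} (P Q P′ Q′ : SetSys n) where
  private
    module G = JoinGraph P Q
    module G′ = JoinGraph P′ Q′

  record Simulation : Set where
    field
      sim         : Node P Q → Node P′ Q′
      sim-linked  : G._—_ =[ sim ]⇒ G′.Linked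
      sim-reaches : ∀ a {u} → u ∈ G.set a → G′.Reaches (sim a) u
      covered     : ∀ a′ {u} → u ∈ G′.set a′ → ¬ ¬ ∃ λ a → u ∈ G.set a
      dominated   : ∀ a′ → ¬ ¬ ∃ λ a → ∀ {u} → G′.Reaches (sim a) u → G′.Reaches a′ u

module _ {n : ℕ} {P Q P′ Q′ : SetSys n} (S : Simulation P Q P′ Q′) where
  private
    module G = JoinGraph P Q
    module G′ = JoinGraph P′ Q′
  open Simulation S

  sim-reaches-via : ∀ {a u} → G.Reaches a u → G′.Reaches (sim a) u
  sim-reaches-via (b , a~b , u∈b) =
    G′.reaches-via (gfold (isEquivalence G′._—_) sim sim-linked a~b) (sim-reaches b u∈b)

  connected-transfer : ∀ {X} → G.Connected X → G′.Connected X
  connected-transfer {X} c = record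
    { root         = sim root
    ; root-reaches = sim-reaches-via ∘ root-reaches
    ; set⊆         = λ a′ {u} u∈a′ → decidable-stable (u ∈? X) λ u∉X →
                       covered a′ u∈a′ λ (a , u∈a) → u∉X (set⊆ a u∈a)
    ; reaches      = λ a′ u∈X ¬reach → dominated a′ λ (a , dom) →
                       reaches a u∈X λ reach → ¬reach (dom (sim-reaches-via reach))
    }
    where open G.Connected c

  simulate : P ∼ Q → P′ ∼ Q′
  simulate h = G′.connected⇒∼ (connected-transfer (proj₂ (G.∼⇒connected h)))

ReflectsConsistency : ∀ {n} → (BSys n → SetSys n) → Set₁
ReflectsConsistency {n} φ = ∀ p → IsPattern ⟦ p ⟧ → ∀ q → IsPattern q → φ p ∼ q →
  Σ (SetSys n) λ q′ → IsPattern q′ × ⟦ p ⟧ ∼ q′ × (∀ r → IsPattern ⟦ r ⟧ → ⟦ r ⟧ ∼ q′ → φ r ∼ q)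

mapFam : ∀ {n} → (BSys n → SetSys n) → BFam n → Fam n
mapFam φ (I , f) = I , φ ∘ f

module _ {n : ℕ} {φ : BSys n → SetSys n} (reflects : ReflectsConsistency φ) where

  someConsistent-map : ∀ {I J : Set} (f : I → BSys n) (g : J → BSys n) →
    (∀ k → IsPattern ⟦ f k ⟧) → (∀ k → IsPattern ⟦ g k ⟧) →
    (∀ q → IsPattern q → (∃ λ k → ⟦ f k ⟧ ∼ q) → ∃ λ k → ⟦ g k ⟧ ∼ q) →
    ∀ q → IsPattern q → (∃ λ k → φ (f k) ∼ q) → ∃ λ k → φ (g k) ∼ q
  someConsistent-map f g pf pg f⇒g q pq (k , φfk∼q) =
    let (q′ , pq′ , fk∼q′ , through) = reflects (f k) (pf k) q pq φfk∼q
        (k′ , gk′∼q′) = f⇒g q′ pq′ (k , fk∼q′)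
    in k′ , through (g k′) (pg k′) gk′∼q′

  represents-mapFam : (S R : BFam n) → PatternFamily S → PatternFamily R →
    Represents (embed R) (embed S) → Represents (mapFam φ R) (mapFam φ S)
  represents-mapFam (_ , s) (_ , r) ps pr rep q pq =
    someConsistent-map s r ps pr (λ q′ pq′ → proj₁ (rep q′ pq′)) q pq ,
    someConsistent-map r s pr ps (λ q′ pq′ → proj₂ (rep q′ pq′)) q pq

module _ {n : ℕ} (i j : Fin n) where

  ij : Subset (suc n)
  ij = ⁅ suc i ⁆ ∪ ⁅ suc j ⁆

  ∈ij⁻ : ∀ {u} → u ∈ ij → u ≡ suc i ⊎ u ≡ suc j
  ∈ij⁻ u∈ with x∈p∪q⁻ ⁅ suc i ⁆ ⁅ suc j ⁆ u∈
  ... | inj₁ u∈i = inj₁ (x∈⁅y⁆⇒x≡y _ u∈i)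
  ... | inj₂ u∈j = inj₂ (x∈⁅y⁆⇒x≡y _ u∈j)

  i∈ij : suc i ∈ ij
  i∈ij = x∈p∪q⁺ (inj₁ (x∈⁅x⁆ (suc i)))

  0∉ij : zero ∉ ij
  0∉ij 0∈ with x∈p∪q⁻ ⁅ suc i ⁆ ⁅ suc j ⁆ 0∈
  ... | inj₁ 0∈i = 0∉⁅suc⁆ i 0∈i
  ... | inj₂ 0∈j = 0∉⁅suc⁆ j 0∈j

  IJPiece : Subset (suc n) → Set
  IJPiece A = A ≡ ⁅ suc i ⁆ ⊎ A ≡ ⁅ suc j ⁆ ⊎ A ≡ ij

  -- The singletons {i}, {j} are there so that consistency with withIJ q forces i, j ∈ lbs.
  withIJ : SetSys n → SetSys n
  withIJ q A = q A ⊎ IJPiece A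

  IJPiece⇒⊆ij : ∀ {A} → IJPiece A → A ⊆ ij
  IJPiece⇒⊆ij (inj₁ refl) u∈ = x∈p∪q⁺ (inj₁ u∈)
  IJPiece⇒⊆ij (inj₂ (inj₁ refl)) u∈ = x∈p∪q⁺ (inj₂ u∈)
  IJPiece⇒⊆ij (inj₂ (inj₂ refl)) u∈ = u∈

  withIJ-pattern : ∀ {q} → IsPattern q → IsPattern (withIJ q)
  withIJ-pattern {q} (B₀ , q₀ , 0∈B₀ , unique) = B₀ , inj₁ q₀ , 0∈B₀ , unique′
    where
    unique′ : ∀ B → withIJ q B → zero ∈ B → B ≡ B₀
    unique′ B (inj₁ b) 0∈B = unique B b 0∈B
    unique′ B (inj₂ piece) 0∈B = ⊥-elim (0∉ij (IJPiece⇒⊆ij piece 0∈B))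

  module _ {P : SetSys n} (ci : Covers P (suc i)) (cj : Covers P (suc j)) where

    ij-covered : ∀ {u} → u ∈ ij → Covers P u
    ij-covered u∈ with ∈ij⁻ u∈
    ... | inj₁ refl = ci
    ... | inj₂ refl = cj

    piece-met : ∀ {B} → IJPiece B → ∃ λ A → P A × Nonempty (A ∩ B)
    piece-met (inj₁ refl) = let (A , a , i∈A) = ci in A , a , _ , x∈p∩q⁺ (i∈A , x∈⁅x⁆ _)
    piece-met (inj₂ (inj₁ refl)) = let (A , a , j∈A) = cj in A , a , _ , x∈p∩q⁺ (j∈A , x∈⁅x⁆ _)
    piece-met (inj₂ (inj₂ refl)) = let (A , a , i∈A) = ci in A , a , _ , x∈p∩q⁺ (i∈A , i∈ij)

    ∼⇒∼withIJ : ∀ {q} → P ∼ q → P ∼ withIJ q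
    ∼⇒∼withIJ {q} = simulate record
      { sim = include ; sim-linked = include-linked ; sim-reaches = include-reaches
      ; covered = covered ; dominated = dominated }
      where
      module G = JoinGraph P q
      module G′ = JoinGraph P (withIJ q)

      include : Node P q → Node P (withIJ q)
      include (inj₁ a) = inj₁ a
      include (inj₂ (B , b)) = inj₂ (B , inj₁ b)

      include-reaches : ∀ a {u} → u ∈ G.set a → G′.Reaches (include a) u
      include-reaches (inj₁ a) = G′.reaches-here (inj₁ a)
      include-reaches (inj₂ (B , b)) = G′.reaches-here (inj₂ (B , inj₁ b))

      include-linked : G._—_ =[ include ]⇒ G′.Linked
      include-linked {inj₁ _} {inj₂ _} meet = return meet
      include-linked {inj₁ _} {inj₁ _} ()
      include-linked {inj₂ _} ()

      covered : ∀ a′ {u} → u ∈ G′.set a′ → ¬ ¬ ∃ λ a → u ∈ G.set a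
      covered (inj₁ a) u∈a = contradiction (inj₁ a , u∈a)
      covered (inj₂ (B , inj₁ b)) u∈B = contradiction (inj₂ (B , b) , u∈B)
      covered (inj₂ (B , inj₂ piece)) u∈B =
        let (A , a , u∈A) = ij-covered (IJPiece⇒⊆ij piece u∈B) in contradiction (inj₁ (A , a) , u∈A)

      dominated : ∀ a′ → ¬ ¬ ∃ λ a → ∀ {u} → G′.Reaches (include a) u → G′.Reaches a′ u
      dominated (inj₁ a) = contradiction (inj₁ a , id)
      dominated (inj₂ (B , inj₁ b)) = contradiction (inj₂ (B , b) , id)
      dominated (inj₂ (B , inj₂ piece)) =
        let (A , a , meet) = piece-met piece in
        contradiction (inj₁ (A , a) , G′.reaches-via (bwd meet ◅ ε))

    ⊔e∼⇒∼withIJ : ∀ {q} → IsPattern P → IsPattern q → (P ⊔ e i j) ∼ q → P ∼ withIJ q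
    ⊔e∼⇒∼withIJ {q} (A₀ , p₀ , 0∈A₀ , _) (B₀ , q₀ , 0∈B₀ , _) = simulate record
      { sim = sim ; sim-linked = sim-linked ; sim-reaches = sim-reaches
      ; covered = covered ; dominated = dominated }
      where
      module PE = JoinGraph P (e i j)
      module G = JoinGraph (P ⊔ e i j) q
      module G′ = JoinGraph P (withIJ q)

      img : Node P (e i j) → Node P (withIJ q)
      img (inj₁ a) = inj₁ a
      img (inj₂ (_ , inj₁ _)) = inj₂ (B₀ , inj₁ q₀)
      img (inj₂ (_ , inj₂ _)) = inj₂ (ij , inj₂ (inj₂ (inj₂ refl)))

      img-⊇ : ∀ c → PE.set c ⊆ G′.set (img c)
      img-⊇ (inj₁ _) u∈ = u∈
      img-⊇ (inj₂ (_ , inj₁ refl)) u∈ = subst (_∈ B₀) (sym (x∈⁅y⁆⇒x≡y _ u∈)) 0∈B₀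
      img-⊇ (inj₂ (_ , inj₂ refl)) u∈ = u∈

      img-linked : PE._—_ =[ img ]⇒ G′.Linked
      img-linked {inj₁ _} {inj₂ (_ , inj₁ refl)} meet = return (zero , x∈p∩q⁺ (meets-⁅⁆⇒∈ meet , 0∈B₀))
      img-linked {inj₁ _} {inj₂ (_ , inj₂ refl)} meet = return meet
      img-linked {inj₁ _} {inj₁ _} ()
      img-linked {inj₂ _} ()

      img-lift : ∀ {c d} → PE.Linked c d → G′.Linked (img c) (img d)
      img-lift = gfold (isEquivalence G′._—_) img img-linked

      img-linked-to : ∀ c {B v} (b : q B) → v ∈ PE.set c → v ∈ B → G′.Linked (img c) (inj₂ (B , inj₁ b))
      img-linked-to (inj₁ _) b v∈A v∈B = return (_ , x∈p∩q⁺ (v∈A , v∈B))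
      img-linked-to (inj₂ (_ , inj₁ refl)) {B} b v∈0 v∈B =
        G′.shared-point-linked p₀ (inj₁ q₀) (inj₁ b) 0∈A₀ 0∈B₀ (subst (_∈ B) (x∈⁅y⁆⇒x≡y _ v∈0) v∈B)
      img-linked-to (inj₂ (_ , inj₂ refl)) b v∈ij v∈B =
        let (A , a , v∈A) = ij-covered v∈ij in
        G′.shared-point-linked a (inj₂ (inj₂ (inj₂ refl))) (inj₁ b) v∈A v∈ij v∈B

      sim : Node (P ⊔ e i j) q → Node P (withIJ q)
      sim (inj₁ (_ , w , _)) = img w
      sim (inj₂ (B , b)) = inj₂ (B , inj₁ b)

      sim-linked : G._—_ =[ sim ]⇒ G′.Linked
      sim-linked {inj₁ (Z , w , w∪)} {inj₂ (B , b)} (v , v∈) with x∈p∩q⁻ Z B v∈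
      ... | v∈Z , v∈B with proj₁ (w∪ v) v∈Z
      ... | c , w~c , v∈c = img-lift w~c ◅◅ img-linked-to c b v∈c v∈B
      sim-linked {inj₁ _} {inj₁ _} ()
      sim-linked {inj₂ _} ()

      sim-reaches : ∀ a {u} → u ∈ G.set a → G′.Reaches (sim a) u
      sim-reaches (inj₁ (_ , w , w∪)) {u} u∈ =
        let (c , w~c , u∈c) = proj₁ (w∪ u) u∈ in img c , img-lift w~c , img-⊇ c u∈c
      sim-reaches (inj₂ (B , b)) = G′.reaches-here (inj₂ (B , inj₁ b))

      classNode : ∀ {A} (a : P A) → ∃ (PE.IsClassUnion (inj₁ (A , a))) → Node (P ⊔ e i j) q
      classNode a (Y , a∪) = inj₁ (Y , inj₁ (_ , a) , a∪)

      covered : ∀ a′ {u} → u ∈ G′.set a′ → ¬ ¬ ∃ λ a → u ∈ G.set a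
      covered (inj₁ (A , a)) u∈A = ¬¬-map
        (λ (Y , a∪) → classNode a (Y , a∪) , proj₂ (a∪ _) (PE.reaches-here _ u∈A))
        (PE.classUnion-¬¬∃ _)
      covered (inj₂ (B , inj₁ b)) u∈B = contradiction (inj₂ (B , b) , u∈B)
      covered (inj₂ (B , inj₂ piece)) u∈B =
        let (A , a , u∈A) = ij-covered (IJPiece⇒⊆ij piece u∈B) in covered (inj₁ (A , a)) u∈A

      dominated : ∀ a′ → ¬ ¬ ∃ λ a → ∀ {u} → G′.Reaches (sim a) u → G′.Reaches a′ u
      dominated (inj₁ (A , a)) = ¬¬-map (λ c → classNode a c , λ {_} reach → reach) (PE.classUnion-¬¬∃ _)
      dominated (inj₂ (B , inj₁ b)) = contradiction (inj₂ (B , b) , id)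
      dominated (inj₂ (B , inj₂ piece)) =
        let (A , a , meet) = piece-met piece in
        ¬¬-map (λ c → classNode a c , λ {_} → G′.reaches-via (bwd meet ◅ ε)) (PE.classUnion-¬¬∃ _)

  ∼withIJ⇒lbs : ∀ {r : BSys n} {q} → IsPattern ⟦ r ⟧ → ⟦ r ⟧ ∼ withIJ q → InLbs r i × InLbs r j
  ∼withIJ⇒lbs {r} {q} (A₀ , r₀ , 0∈A₀ , _) h =
    singleton-covered i (inj₂ (inj₁ refl)) , singleton-covered j (inj₂ (inj₂ (inj₁ refl)))
    where
    open JoinGraph ⟦ r ⟧ (withIJ q)
    open Connected (proj₂ (∼⇒connected h))

    singleton-covered : ∀ k → withIJ q ⁅ suc k ⁆ → InLbs r k
    singleton-covered k piece = decidable-stable (inLbs? r k) λ ¬lbs →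
      reaches (inj₂ (_ , piece)) (set⊆ (inj₁ (A₀ , r₀)) 0∈A₀) λ reach →
        let (A , a , meet) = escape⇒meets piece reach (0∉⁅suc⁆ k) in ¬lbs (A , a , meets-⁅⁆⇒∈ meet)

  -- In r ⊔ {{0},{i,j}} the class of {i,j} gathers the members of r meeting {i,j} (and {0}
  -- when the 0-member of r does); every other member of r forms a class on its own.
  module IJClasses {r : BSys n} (q : SetSys n) {A₀ : Subset (suc n)} (r₀ : ⟦ r ⟧ A₀)
    (0∈A₀ : zero ∈ A₀) (unique₀ : ∀ B → ⟦ r ⟧ B → zero ∈ B → B ≡ A₀) (ci : InLbs r i) where

    private
      R = ⟦ r ⟧
      E = e i j
      module RE = JoinGraph R E
      module G = JoinGraph R (withIJ q)
      module G′ = JoinGraph (R ⊔ E) q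

    Touches : Subset (suc n) → Set
    Touches S = Nonempty (S ∩ ij)

    touches? : ∀ S → Dec (Touches S)
    touches? S = nonempty? (S ∩ ij)

    InIJClass : Fin (suc n) → Set
    InIJClass u = u ∈ ij ⊎ ∃ λ S → R S × Touches S × u ∈ S

    inIJClass? : ∀ u → Dec (InIJClass u)
    inIJClass? u = (u ∈? ij) ⊎-dec anySubset? λ S → (r S ≟B true) ×-dec touches? S ×-dec (u ∈? S)

    ijNode : Node R E
    ijNode = inj₂ (ij , inj₂ refl)

    ijClass-union : RE.IsClassUnion ijNode (fromDec inIJClass?)
    ijClass-union = RE.classUnion-of-invariant I step tt bound spans
      where
      I : Node R E → Set
      I (inj₁ (S , _)) = Touches S
      I (inj₂ (_ , inj₁ _)) = Touches A₀
      I (inj₂ (_ , inj₂ _)) = ⊤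

      step : ∀ {a b} → a RE.— b → I a ⇔ I b
      step {inj₁ (S , s)} {inj₂ (_ , inj₁ refl)} meet =
        let S≡A₀ = unique₀ S s (meets-⁅⁆⇒∈ meet) in mk⇔ (subst Touches S≡A₀) (subst Touches (sym S≡A₀))
      step {inj₁ _} {inj₂ (_ , inj₂ refl)} touch = mk⇔ (λ _ → tt) (λ _ → touch)
      step {inj₁ _} {inj₁ _} ()
      step {inj₂ _} ()

      bound : ∀ b → I b → RE.set b ⊆ fromDec inIJClass?
      bound (inj₁ (S , s)) touch u∈S = ∈-fromDec⁺ inIJClass? (inj₂ (S , s , touch , u∈S))
      bound (inj₂ (_ , inj₁ refl)) touch u∈0 = ∈-fromDec⁺ inIJClass?
        (inj₂ (A₀ , r₀ , touch , subst (_∈ A₀) (sym (x∈⁅y⁆⇒x≡y _ u∈0)) 0∈A₀))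
      bound (inj₂ (_ , inj₂ refl)) _ u∈ij = ∈-fromDec⁺ inIJClass? (inj₁ u∈ij)

      spans : ∀ {u} → u ∈ fromDec inIJClass? → RE.Reaches ijNode u
      spans u∈ with ∈-fromDec⁻ inIJClass? u∈
      ... | inj₁ u∈ij = RE.reaches-here ijNode u∈ij
      ... | inj₂ (S , s , touch , u∈S) = inj₁ (S , s) , bwd touch ◅ ε , u∈S

    isolated-union : ∀ {S} (s : R S) → ¬ Touches S → RE.IsClassUnion (inj₁ (S , s)) S
    isolated-union {S} s ¬touch = RE.classUnion-of-invariant I step refl bound (RE.reaches-here _)
      where
      I : Node R E → Set
      I (inj₁ (S′ , _)) = S′ ≡ S
      I (inj₂ (_ , inj₁ _)) = zero ∈ S
      I (inj₂ (_ , inj₂ _)) = ⊥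

      step : ∀ {a b} → a RE.— b → I a ⇔ I b
      step {inj₁ (S′ , s′)} {inj₂ (_ , inj₁ refl)} meet =
        let 0∈S′ = meets-⁅⁆⇒∈ meet in
        mk⇔ (λ { refl → 0∈S′ }) (λ 0∈S → trans (unique₀ S′ s′ 0∈S′) (sym (unique₀ S s 0∈S)))
      step {inj₁ _} {inj₂ (_ , inj₂ refl)} touch = mk⇔ (λ { refl → ¬touch touch }) ⊥-elim
      step {inj₁ _} {inj₁ _} ()
      step {inj₂ _} ()

      bound : ∀ b → I b → RE.set b ⊆ S
      bound (inj₁ _) refl u∈S = u∈S
      bound (inj₂ (_ , inj₁ refl)) 0∈S u∈0 = subst (_∈ S) (sym (x∈⁅y⁆⇒x≡y _ u∈0)) 0∈S
      bound (inj₂ (_ , inj₂ refl)) ()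

    ijClassNode : Node (R ⊔ E) q
    ijClassNode = inj₁ (fromDec inIJClass? , ijNode , ijClass-union)

    classOf : ∀ {S} → R S → Dec (Touches S) → Σ (Subset (suc n)) (R ⊔ E)
    classOf _ (yes _) = fromDec inIJClass? , ijNode , ijClass-union
    classOf s (no ¬touch) = _ , inj₁ (_ , s) , isolated-union s ¬touch

    classOf-⊇ : ∀ {S} (s : R S) d → S ⊆ proj₁ (classOf s d)
    classOf-⊇ s (yes touch) u∈S = ∈-fromDec⁺ inIJClass? (inj₂ (_ , s , touch , u∈S))
    classOf-⊇ s (no _) u∈S = u∈S

    classOf-⊆ : ∀ {S} (s : R S) d {w Z} → RE.IsClassUnion w Z → RE.Linked w (inj₁ (S , s)) →
      proj₁ (classOf s d) ⊆ Z
    classOf-⊆ s (yes touch) w∪ w~S = RE.classUnion-⊆ ijClass-union w∪ (w~S ◅◅ return touch)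
    classOf-⊆ s (no ¬touch) w∪ w~S = RE.classUnion-⊆ (isolated-union s ¬touch) w∪ w~S

    classOf-touching : ∀ {S} (s : R S) → Touches S → ∀ d → G′.Linked (inj₁ (classOf s d)) ijClassNode
    classOf-touching s _ (yes _) = ε
    classOf-touching s touch (no ¬touch) = ⊥-elim (¬touch touch)

    linked-member : ∀ w → ∃ λ (a : Σ (Subset (suc n)) R) → RE.Linked w (inj₁ a)
    linked-member (inj₁ a) = a , ε
    linked-member (inj₂ (_ , inj₁ refl)) = (A₀ , r₀) , bwd (zero , x∈p∩q⁺ (0∈A₀ , x∈⁅x⁆ zero)) ◅ ε
    linked-member (inj₂ (_ , inj₂ refl)) =
      let (Si , si , i∈Si) = ci in (Si , si) , bwd (suc i , x∈p∩q⁺ (i∈Si , i∈ij)) ◅ ε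

    sim : Node R (withIJ q) → Node (R ⊔ E) q
    sim (inj₁ (S , s)) = inj₁ (classOf s (touches? S))
    sim (inj₂ (B , inj₁ b)) = inj₂ (B , b)
    sim (inj₂ (_ , inj₂ _)) = ijClassNode

    sim-linked : G._—_ =[ sim ]⇒ G′.Linked
    sim-linked {inj₁ (S , s)} {inj₂ (_ , inj₁ _)} meet = return (meets-⊆ˡ (classOf-⊇ s (touches? S)) meet)
    sim-linked {inj₁ (S , s)} {inj₂ (_ , inj₂ piece)} meet =
      classOf-touching s (meets-⊆ʳ (IJPiece⇒⊆ij piece) meet) _
    sim-linked {inj₁ _} {inj₁ _} ()
    sim-linked {inj₂ _} ()

    sim-reaches : ∀ a {u} → u ∈ G.set a → G′.Reaches (sim a) u
    sim-reaches (inj₁ (S , s)) u∈S = G′.reaches-here _ (classOf-⊇ s (touches? S) u∈S)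
    sim-reaches (inj₂ (B , inj₁ b)) = G′.reaches-here (inj₂ (B , b))
    sim-reaches (inj₂ (_ , inj₂ piece)) u∈ =
      G′.reaches-here ijClassNode (∈-fromDec⁺ inIJClass? (inj₁ (IJPiece⇒⊆ij piece u∈)))

    member : ∀ c {u} → u ∈ RE.set c → ∃ λ a → u ∈ G.set a
    member (inj₁ a) u∈ = inj₁ a , u∈
    member (inj₂ (_ , inj₁ refl)) u∈0 = inj₁ (A₀ , r₀) , subst (_∈ A₀) (sym (x∈⁅y⁆⇒x≡y _ u∈0)) 0∈A₀
    member (inj₂ (_ , inj₂ refl)) u∈ij = inj₂ (ij , inj₂ (inj₂ (inj₂ refl))) , u∈ij

    covered : ∀ a′ {u} → u ∈ G′.set a′ → ¬ ¬ ∃ λ a → u ∈ G.set a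
    covered (inj₁ (_ , _ , w∪)) {u} u∈ =
      let (c , _ , u∈c) = proj₁ (w∪ u) u∈ in contradiction (member c u∈c)
    covered (inj₂ (B , b)) u∈B = contradiction (inj₂ (B , inj₁ b) , u∈B)

    dominated : ∀ a′ → ¬ ¬ ∃ λ a → ∀ {u} → G′.Reaches (sim a) u → G′.Reaches a′ u
    dominated (inj₁ (_ , w , w∪)) =
      let ((S , s) , w~S) = linked-member w in
      contradiction (inj₁ (S , s) , G′.reaches-⊆ˡ _ _ (classOf-⊆ s (touches? S) w∪ w~S))
    dominated (inj₂ (B , b)) = contradiction (inj₂ (B , inj₁ b) , λ {_} reach → reach)

    simulation : Simulation R (withIJ q) (R ⊔ E) q
    simulation = record
      { sim = sim ; sim-linked = sim-linked ; sim-reaches = sim-reaches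
      ; covered = covered ; dominated = dominated }

  ∼withIJ⇒⊔e∼ : ∀ {r : BSys n} {q} → IsPattern ⟦ r ⟧ → InLbs r i → ⟦ r ⟧ ∼ withIJ q → (⟦ r ⟧ ⊔ e i j) ∼ q
  ∼withIJ⇒⊔e∼ {q = q} (_ , r₀ , 0∈A₀ , unique₀) ci = simulate (IJClasses.simulation q r₀ 0∈A₀ unique₀ ci)

  ∼withIJ⇒η∼ : ∀ {q} r → IsPattern ⟦ r ⟧ → ⟦ r ⟧ ∼ withIJ q → η i j r ∼ q
  ∼withIJ⇒η∼ r pr h with inLbs? r i ×-dec inLbs? r j
  ... | yes (ci , _) = ∼withIJ⇒⊔e∼ pr ci h
  ... | no ¬lbs = ⊥-elim (¬lbs (∼withIJ⇒lbs pr h))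

  ∼⇒η∼ : ∀ {q} r → IsPattern ⟦ r ⟧ → ⟦ r ⟧ ∼ q → η i j r ∼ q
  ∼⇒η∼ r pr h with inLbs? r i ×-dec inLbs? r j
  ... | yes (ci , cj) = ∼withIJ⇒⊔e∼ pr ci (∼⇒∼withIJ ci cj h)
  ... | no _ = h

  η-reflectsConsistency : ReflectsConsistency (η i j)
  η-reflectsConsistency s ps q pq h with inLbs? s i ×-dec inLbs? s j
  ... | yes (ci , cj) = withIJ q , withIJ-pattern pq , ⊔e∼⇒∼withIJ ci cj ps pq h , ∼withIJ⇒η∼
  ... | no _ = q , pq , h , ∼⇒η∼

lemma6p5 : ∀ (n : ℕ) (i j : Fin n) → i ≢ j →
    (S R : BFam n) → PatternFamily S → PatternFamily R →
    Represents (embed R) (embed S) →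
    Represents (ηFam i j R) (ηFam i j S)
lemma6p5 n i j _ = represents-mapFam (η-reflectsConsistency i j)
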